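{- Let the Fibonacci polynomials over $\mathbb{F}_2$ be defined by $f_1(x)=1$, $f_2(x)=x$, $f_{n+2}(x)=xf_{n+1}(x)+f_n(x)$. Then for every integer $k\ge1$, \[ f_{2^k-1}(x)=\sum_{\ell=1}^k x^{2^k-2^\ell}\quad\text{and}\quad f_{2^k}(x)=x^{2^k-1}. \] -}

module Defs where

open import Data.Bool using (Bool; true; false; _xor_)
open import Relation.Binary.PropositionalEquality using (_≡_)
open import Data.Nat using (ℕ; zero; suc; _≡ᵇ_; _^_; _∸_)

-- Polynomials over F₂ = Bool (with xor as addition), represented by their
-- coefficient sequences: p i is the coefficient of x^i.
-- All polynomials built below have finite support.
Poly : Set
Poly = ℕ → Bool

_≈_ : Poly → Poly → Set
p ≈ q = ∀ i → p i ≡ q i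

𝟘 : Poly
𝟘 _ = false

_⊕_ : Poly → Poly → Poly
(p ⊕ q) i = p i xor q i

X* : Poly → Poly
X* p zero    = false
X* p (suc i) = p i

xpow : ℕ → Poly
xpow m i = i ≡ᵇ m

-- Fibonacci polynomials over F₂, indexed from 0 with f₀ = 0 (consistent
-- with f₂ = x f₁ + f₀); f₁ = 1, f₂ = x, f_{n+2} = x f_{n+1} + f_n.
fib : ℕ → Poly
fib zero          = 𝟘
fib (suc zero)    = xpow 0
fib (suc (suc n)) = X* (fib (suc n)) ⊕ fib n

sumTerms : ℕ → ℕ → Poly
sumTerms k zero      = 𝟘
sumTerms k (suc ℓ)   = sumTerms k ℓ ⊕ xpow (2 ^ k ∸ 2 ^ suc ℓ)

{-# OPTIONS --safe #-}
-- Over F₂ the Fibonacci polynomials satisfy f_{N+j} = f_{N-j} + x f_N f_j for j ≤ N: as functions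
-- of j both sides obey the Fibonacci recurrence (the reversed sequence does so because -1 = 1)
-- and they agree at j = 0, 1. When f_N = x^(N-1) this reads f_{N+j} = f_{N-j} + x^N f_j, so j = N
-- gives f_{2N} = x^(2N-1) and j = N - 1 gives f_{2N-1} = 1 + x^N f_{N-1}. Induction on k with
-- N = 2^k gives both identities, multiplication by x^(2^k) turning x^(2^k - 2^l) into
-- x^(2^(k+1) - 2^l).
module Submission where

open import Algebra.Bundles using (AbelianGroup; CommutativeRing)
import Algebra.Construct.Pointwise as Pointwise
import Algebra.Properties.CommutativeSemigroup as CommutativeSemigroupProperties
import Algebra.Properties.Group as GroupProperties
open import Data.Bool.Properties using (xor-∧-commutativeRing)
open import Data.Nat using (ℕ; zero; suc; _+_; _*_; _^_; _∸_; _≤_; _≥_; s≤s)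
open import Data.Nat.Properties using (+-suc; +-identityʳ; +-∸-assoc; n∸n≡0; m+n∸n≡m; n≤1+n; ^-monoʳ-≤; ≤-refl; <⇒≤)
open import Data.Product using (_×_; _,_; proj₂)
open import Level using (0ℓ)
open import Relation.Nullary using (contradiction)
open import Relation.Binary.PropositionalEquality as ≡ using (_≡_)

open import Defs

⊕-abelianGroup : AbelianGroup 0ℓ 0ℓ
⊕-abelianGroup = Pointwise.abelianGroup ℕ (CommutativeRing.+-abelianGroup xor-∧-commutativeRing)

open AbelianGroup ⊕-abelianGroup
  using (setoid; refl; sym; ∙-cong; ∙-congˡ; ∙-congʳ; comm; identityˡ; identityʳ)
open GroupProperties (AbelianGroup.group ⊕-abelianGroup) using (\\-leftDividesʳ)
open CommutativeSemigroupProperties (AbelianGroup.commutativeSemigroup ⊕-abelianGroup)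
  using (interchange)
open import Relation.Binary.Reasoning.Setoid setoid

X*-cong : ∀ {p q} → p ≈ q → X* p ≈ X* q
X*-cong p≈q zero    = ≡.refl
X*-cong p≈q (suc i) = p≈q i

X*-⊕ : ∀ p q → X* (p ⊕ q) ≈ (X* p ⊕ X* q)
X*-⊕ p q zero    = ≡.refl
X*-⊕ p q (suc i) = ≡.refl

X*-𝟘 : X* 𝟘 ≈ 𝟘
X*-𝟘 zero    = ≡.refl
X*-𝟘 (suc i) = ≡.refl

X*-xpow : ∀ m → X* (xpow m) ≈ xpow (suc m)
X*-xpow m zero    = ≡.refl
X*-xpow m (suc i) = ≡.refl

shift : ℕ → Poly → Poly
shift zero    p = p
shift (suc m) p = X* (shift m p)

shift-cong : ∀ m {p q} → p ≈ q → shift m p ≈ shift m q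
shift-cong zero    p≈q = p≈q
shift-cong (suc m) p≈q = X*-cong (shift-cong m p≈q)

shift-⊕ : ∀ m p q → shift m (p ⊕ q) ≈ (shift m p ⊕ shift m q)
shift-⊕ zero    p q = refl
shift-⊕ (suc m) p q = begin
  X* (shift m (p ⊕ q))              ≈⟨ X*-cong (shift-⊕ m p q) ⟩
  X* (shift m p ⊕ shift m q)        ≈⟨ X*-⊕ (shift m p) (shift m q) ⟩
  (X* (shift m p) ⊕ X* (shift m q)) ∎

shift-X* : ∀ m p → shift m (X* p) ≈ X* (shift m p)
shift-X* zero    p = refl
shift-X* (suc m) p = X*-cong (shift-X* m p)

shift-𝟘 : ∀ m → shift m 𝟘 ≈ 𝟘
shift-𝟘 zero    = refl
shift-𝟘 (suc m) = begin
  X* (shift m 𝟘) ≈⟨ X*-cong (shift-𝟘 m) ⟩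
  X* 𝟘           ≈⟨ X*-𝟘 ⟩
  𝟘              ∎

shift-xpow : ∀ m n → shift m (xpow n) ≈ xpow (m + n)
shift-xpow zero    n = refl
shift-xpow (suc m) n = begin
  X* (shift m (xpow n)) ≈⟨ X*-cong (shift-xpow m n) ⟩
  X* (xpow (m + n))     ≈⟨ X*-xpow (m + n) ⟩
  xpow (suc m + n)      ∎

-- Bounded so that j ↦ fib (N ∸ j) qualifies for n = N despite truncated subtraction.
FibonacciUpTo : ℕ → (ℕ → Poly) → Set
FibonacciUpTo n g = ∀ j → 2 + j ≤ n → g (2 + j) ≈ (X* (g (1 + j)) ⊕ g j)

fibonacciUpTo-unique : ∀ {n g h} → FibonacciUpTo n g → FibonacciUpTo n h →
                       g 0 ≈ h 0 → g 1 ≈ h 1 → ∀ j → j ≤ n → g j ≈ h j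
fibonacciUpTo-unique {n} {g} {h} g-rec h-rec g₀≈h₀ g₁≈h₁ = agree
  where
  agree₂ : ∀ j → suc j ≤ n → g j ≈ h j × g (suc j) ≈ h (suc j)
  agree₂ zero    _     = g₀≈h₀ , g₁≈h₁
  agree₂ (suc j) 2+j≤n with agree₂ j (<⇒≤ 2+j≤n)
  ... | gⱼ≈hⱼ , gⱼ₊₁≈hⱼ₊₁ = gⱼ₊₁≈hⱼ₊₁ , (begin
    g (2 + j)                ≈⟨ g-rec j 2+j≤n ⟩
    (X* (g (1 + j)) ⊕ g j)   ≈⟨ ∙-cong (X*-cong gⱼ₊₁≈hⱼ₊₁) gⱼ≈hⱼ ⟩
    (X* (h (1 + j)) ⊕ h j)   ≈⟨ h-rec j 2+j≤n ⟨
    h (2 + j)                ∎)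

  agree : ∀ j → j ≤ n → g j ≈ h j
  agree zero    _   = g₀≈h₀
  agree (suc j) j<n = proj₂ (agree₂ j j<n)

⊕-fibonacciUpTo : ∀ {n g h} → FibonacciUpTo n g → FibonacciUpTo n h →
                  FibonacciUpTo n (λ j → g j ⊕ h j)
⊕-fibonacciUpTo {g = g} {h} g-rec h-rec j 2+j≤n = begin
  (g (2 + j) ⊕ h (2 + j))                               ≈⟨ ∙-cong (g-rec j 2+j≤n) (h-rec j 2+j≤n) ⟩
  ((X* (g (1 + j)) ⊕ g j) ⊕ (X* (h (1 + j)) ⊕ h j))     ≈⟨ interchange (X* (g (1 + j))) (g j) (X* (h (1 + j))) (h j) ⟩
  ((X* (g (1 + j)) ⊕ X* (h (1 + j))) ⊕ (g j ⊕ h j))     ≈⟨ ∙-congʳ (X*-⊕ (g (1 + j)) (h (1 + j))) ⟨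
  (X* (g (1 + j) ⊕ h (1 + j)) ⊕ (g j ⊕ h j))            ∎

shift-fibonacciUpTo : ∀ m {n g} → FibonacciUpTo n g → FibonacciUpTo n (λ j → shift m (g j))
shift-fibonacciUpTo m {g = g} g-rec j 2+j≤n = begin
  shift m (g (2 + j))                              ≈⟨ shift-cong m (g-rec j 2+j≤n) ⟩
  shift m (X* (g (1 + j)) ⊕ g j)                   ≈⟨ shift-⊕ m (X* (g (1 + j))) (g j) ⟩
  (shift m (X* (g (1 + j))) ⊕ shift m (g j))       ≈⟨ ∙-congʳ (shift-X* m (g (1 + j))) ⟩
  (X* (shift m (g (1 + j))) ⊕ shift m (g j))       ∎

fib-fibonacci : ∀ {n} → FibonacciUpTo n fib
fib-fibonacci _ _ = refl

fib-+-fibonacci : ∀ N {n} → FibonacciUpTo n (λ j → fib (j + N))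
fib-+-fibonacci N _ _ = refl

-- The group inverse is the identity, so x ⁻¹ ∙ (x ∙ y) ≈ y is the recurrence solved for fib i.
fib-backward : ∀ i → fib i ≈ (X* (fib (1 + i)) ⊕ fib (2 + i))
fib-backward i = sym (\\-leftDividesʳ (X* (fib (1 + i))) (fib i))

fib-∸-fibonacci : ∀ N → FibonacciUpTo N (λ j → fib (N ∸ j))
fib-∸-fibonacci (suc (suc M)) zero    _           = fib-backward M
fib-∸-fibonacci (suc N)       (suc j) (s≤s 2+j≤N) = fib-∸-fibonacci N j 2+j≤N

fib-reflection : ∀ {N} → fib N ≈ xpow (N ∸ 1) →
                 ∀ j → j ≤ N → fib (j + N) ≈ (fib (N ∸ j) ⊕ shift N (fib j))
fib-reflection {zero}  fib₀≈1 = contradiction (fib₀≈1 0) λ ()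
fib-reflection {suc M} fib[N]≈xᴹ =
  fibonacciUpTo-unique (fib-+-fibonacci N)
                       (⊕-fibonacciUpTo (fib-∸-fibonacci N) (shift-fibonacciUpTo N fib-fibonacci))
                       initial₀ initial₁
  where
  N = suc M

  initial₀ : fib N ≈ (fib N ⊕ shift N 𝟘)
  initial₀ = begin
    fib N                ≈⟨ identityʳ (fib N) ⟨
    (fib N ⊕ 𝟘)          ≈⟨ ∙-congˡ {fib N} (shift-𝟘 N) ⟨
    (fib N ⊕ shift N 𝟘)  ∎

  initial₁ : fib (suc N) ≈ (fib M ⊕ shift N (xpow 0))
  initial₁ = begin
    (X* (fib N) ⊕ fib M)        ≈⟨ ∙-congʳ (X*-cong fib[N]≈xᴹ) ⟩
    (X* (xpow M) ⊕ fib M)       ≈⟨ ∙-congʳ (X*-xpow M) ⟩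
    (xpow N ⊕ fib M)            ≈⟨ comm (xpow N) (fib M) ⟩
    (fib M ⊕ xpow N)            ≡⟨ ≡.cong (λ n → fib M ⊕ xpow n) (+-identityʳ N) ⟨
    (fib M ⊕ xpow (N + 0))      ≈⟨ ∙-congˡ {fib M} (shift-xpow N 0) ⟨
    (fib M ⊕ shift N (xpow 0))  ∎

2*n≡n+n : ∀ n → 2 * n ≡ n + n
2*n≡n+n n = ≡.cong (n +_) (+-identityʳ n)

fib-double : ∀ N → fib N ≈ xpow (N ∸ 1) → fib (2 * N) ≈ xpow (2 * N ∸ 1)
fib-double zero    fib₀≈1     = contradiction (fib₀≈1 0) λ ()
fib-double (suc M) fib[N]≈xᴹ = begin
  fib (2 * N)                     ≡⟨ ≡.cong fib (2*n≡n+n N) ⟩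
  fib (N + N)                     ≈⟨ fib-reflection fib[N]≈xᴹ N ≤-refl ⟩
  (fib (N ∸ N) ⊕ shift N (fib N)) ≡⟨ ≡.cong (λ n → fib n ⊕ shift N (fib N)) (n∸n≡0 N) ⟩
  (𝟘 ⊕ shift N (fib N))           ≈⟨ identityˡ (shift N (fib N)) ⟩
  shift N (fib N)                 ≈⟨ shift-cong N fib[N]≈xᴹ ⟩
  shift N (xpow M)                ≈⟨ shift-xpow N M ⟩
  xpow (N + M)                    ≡⟨ ≡.cong xpow (+-suc M M) ⟨
  xpow (M + N)                    ≡⟨ ≡.cong (λ n → xpow (n ∸ 1)) (2*n≡n+n N) ⟨
  xpow (2 * N ∸ 1)                ∎
  where N = suc M

fib-double∸1 : ∀ N → fib N ≈ xpow (N ∸ 1) → fib (2 * N ∸ 1) ≈ (xpow 0 ⊕ shift N (fib (N ∸ 1)))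
fib-double∸1 zero    fib₀≈1     = contradiction (fib₀≈1 0) λ ()
fib-double∸1 (suc M) fib[N]≈xᴹ = begin
  fib (2 * N ∸ 1)                 ≡⟨ ≡.cong (λ n → fib (n ∸ 1)) (2*n≡n+n N) ⟩
  fib (M + N)                     ≈⟨ fib-reflection fib[N]≈xᴹ M (n≤1+n M) ⟩
  (fib (N ∸ M) ⊕ shift N (fib M)) ≡⟨ ≡.cong (λ n → fib n ⊕ shift N (fib M)) (m+n∸n≡m 1 M) ⟩
  (xpow 0 ⊕ shift N (fib M))      ∎
  where N = suc M

shift-sumTerms : ∀ k {ℓ} → ℓ ≤ k → shift (2 ^ k) (sumTerms k ℓ) ≈ sumTerms (suc k) ℓ
shift-sumTerms k {zero}  _     = shift-𝟘 (2 ^ k)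
shift-sumTerms k {suc ℓ} 1+ℓ≤k = begin
  shift (2 ^ k) (sumTerms k ℓ ⊕ xpow (2 ^ k ∸ 2 ^ suc ℓ))
    ≈⟨ shift-⊕ (2 ^ k) (sumTerms k ℓ) (xpow (2 ^ k ∸ 2 ^ suc ℓ)) ⟩
  (shift (2 ^ k) (sumTerms k ℓ) ⊕ shift (2 ^ k) (xpow (2 ^ k ∸ 2 ^ suc ℓ)))
    ≈⟨ ∙-cong (shift-sumTerms k (<⇒≤ 1+ℓ≤k)) (shift-xpow (2 ^ k) (2 ^ k ∸ 2 ^ suc ℓ)) ⟩
  (sumTerms (suc k) ℓ ⊕ xpow (2 ^ k + (2 ^ k ∸ 2 ^ suc ℓ)))
    ≡⟨ ≡.cong (λ n → sumTerms (suc k) ℓ ⊕ xpow n) exponent ⟨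
  sumTerms (suc k) (suc ℓ) ∎
  where
  exponent : 2 ^ suc k ∸ 2 ^ suc ℓ ≡ 2 ^ k + (2 ^ k ∸ 2 ^ suc ℓ)
  exponent = ≡.trans (≡.cong (_∸ 2 ^ suc ℓ) (2*n≡n+n (2 ^ k)))
                     (+-∸-assoc (2 ^ k) (^-monoʳ-≤ 2 1+ℓ≤k))

fib[2^k]≈xpow[2^k∸1] : ∀ k → fib (2 ^ k) ≈ xpow (2 ^ k ∸ 1)
fib[2^k]≈xpow[2^k∸1] zero    = refl
fib[2^k]≈xpow[2^k∸1] (suc k) = fib-double (2 ^ k) (fib[2^k]≈xpow[2^k∸1] k)

fib[2^k∸1]≈sumTerms : ∀ k → fib (2 ^ k ∸ 1) ≈ sumTerms k k
fib[2^k∸1]≈sumTerms zero    = refl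
fib[2^k∸1]≈sumTerms (suc k) = begin
  fib (2 ^ suc k ∸ 1)                           ≈⟨ fib-double∸1 (2 ^ k) (fib[2^k]≈xpow[2^k∸1] k) ⟩
  (xpow 0 ⊕ shift (2 ^ k) (fib (2 ^ k ∸ 1)))    ≈⟨ ∙-congˡ {xpow 0} (shift-cong (2 ^ k) (fib[2^k∸1]≈sumTerms k)) ⟩
  (xpow 0 ⊕ shift (2 ^ k) (sumTerms k k))       ≈⟨ ∙-congˡ {xpow 0} (shift-sumTerms k ≤-refl) ⟩
  (xpow 0 ⊕ sumTerms (suc k) k)                 ≈⟨ comm (xpow 0) (sumTerms (suc k) k) ⟩
  (sumTerms (suc k) k ⊕ xpow 0)                 ≡⟨ ≡.cong (λ n → sumTerms (suc k) k ⊕ xpow n) (n∸n≡0 (2 ^ suc k)) ⟨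
  sumTerms (suc k) (suc k)                      ∎

mainTheorem14 : ∀ (k : ℕ) → k ≥ 1 → (fib (2 ^ k ∸ 1) ≈ sumTerms k k) × (fib (2 ^ k) ≈ xpow (2 ^ k ∸ 1))
mainTheorem14 k _ = fib[2^k∸1]≈sumTerms k , fib[2^k]≈xpow[2^k∸1] k
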